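{- Let $R$ be a commutative ring with unity. (a) For every $n$-ary function symbol $F$ of $L_R$ there is a map $g_F:R^n\to R$ such that for every torsion $R$-module $M$, all $a_1,\dots,a_n\in M$ and all $r_k\in\mathcal{O}^M(a_k)$ ($k=1,\dots,n$), we have $g_F(r_1,\dots,r_n)\in\mathcal{O}^M(F(a_1,\dots,a_n))$. (b) Consequently, for every family $\{M_i:i\in I\}$ of torsion $R$-modules and ultrafilter $U$ on $I$, $\prod^{tor}M_i/U$ is a substructure of $\prod M_i/U$, and for every universal formula $\phi(x_0,\dots,x_{n-1})$ and $[f_0]_U,\dots,[f_{n-1}]_U\in\prod^{tor}M_i/U$, if $\{i\in I:M_i\models\phi(f_0(i),\dots,f_{n-1}(i))\}\in U$ then $\prod^{tor}M_i/U\models\phi([f_0]_U,\dots,[f_{n-1}]_U)$.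
   Context: $L_R=\langle +,-,0,(r\cdot)_{r\in R}\rangle$ is the language of $R$-modules. For a module $M$ and $m\in M$, $\mathcal{O}^M(m)=\{r\in R: r\cdot m=0\text{ and } r\text{ is regular (not a zero divisor)}\}$; $M$ is a torsion module if $\mathcal{O}^M(m)\neq\emptyset$ for all $m\in M$. The torsion ultraproduct $\prod^{tor}M_i/U$ is the subset of $\prod M_i/U$ consisting of $[f]_U$ such that there are $X_f\in U$ and $r_f\in R$ with $r_f\in\mathcal{O}^{M_i}(f(i))$ for all $i\in X_f$, with operations inherited from $\prod M_i/U$. -}

module Defs where

open import Level using (Level; _⊔_; Lift) renaming (suc to lsuc)
open import Algebra.Bundles using (CommutativeRing)
open import Algebra.Module.Bundles using (Module)
open import Data.Nat using (ℕ) renaming (suc to nsuc)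
open import Data.Fin using (Fin; zero; suc)
open import Data.Product using (Σ; _×_; _,_; proj₁; proj₂)
open import Data.Sum using (_⊎_)
open import Data.Empty using (⊥)
open import Data.Unit using (⊤)
open import Relation.Nullary using (¬_)

record Ultrafilter {ι : Level} (I : Set ι) (p : Level) : Set (ι ⊔ lsuc p) where
  field
    _∈U : (I → Set p) → Set p
    full   : (λ _ → Lift p ⊤) ∈U
    proper : ¬ ((λ _ → Lift p ⊥) ∈U)
    mono   : ∀ {X Y : I → Set p} → (∀ i → X i → Y i) → X ∈U → Y ∈U
    inter  : ∀ {X Y : I → Set p} → X ∈U → Y ∈U → (λ i → X i × Y i) ∈U
    ultra  : ∀ (X : I → Set p) → (X ∈U) ⊎ ((λ i → ¬ X i) ∈U)

open Ultrafilter public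

module _ {c ℓ : Level} (R : CommutativeRing c ℓ) where
  open CommutativeRing R using (_≈_; _*_; 0#) renaming (Carrier to Rc)

  data FunSym : ℕ → Set c where
    plus : FunSym 2
    neg  : FunSym 1
    zer  : FunSym 0
    scal : Rc → FunSym 1

  Regular : Rc → Set (c ⊔ ℓ)
  Regular r = ∀ s → r * s ≈ 0# → s ≈ 0#

  record Structure (a e : Level) : Set (c ⊔ lsuc (a ⊔ e)) where
    field
      Carrier : Set a
      _≈ˢ_    : Carrier → Carrier → Set e
      interp  : ∀ {n} → FunSym n → (Fin n → Carrier) → Carrier

  open Structure public

  data Term (n : ℕ) : Set c where
    var : Fin n → Term n
    app : ∀ {k} → FunSym k → (Fin k → Term n) → Term n

  data QF (n : ℕ) : Set c where
    _≐_  : Term n → Term n → QF n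
    ¬'_  : QF n → QF n
    _∧'_ : QF n → QF n → QF n
    _∨'_ : QF n → QF n → QF n
    _⇒'_ : QF n → QF n → QF n

  data Univ (n : ℕ) : Set c where
    qf  : QF n → Univ n
    all : Univ (nsuc n) → Univ n

  module _ {a e : Level} (S : Structure a e) where
    eval : ∀ {n} → (Fin n → Carrier S) → Term n → Carrier S
    eval ρ (var x)    = ρ x
    eval ρ (app F ts) = interp S F (λ k → eval ρ (ts k))

    SatQF : ∀ {n} → QF n → (Fin n → Carrier S) → Set e
    SatQF (t ≐ u)  ρ = _≈ˢ_ S (eval ρ t) (eval ρ u)
    SatQF (¬' φ)   ρ = ¬ SatQF φ ρ
    SatQF (φ ∧' ψ) ρ = SatQF φ ρ × SatQF ψ ρ
    SatQF (φ ∨' ψ) ρ = SatQF φ ρ ⊎ SatQF ψ ρ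
    SatQF (φ ⇒' ψ) ρ = SatQF φ ρ → SatQF ψ ρ

    extend : ∀ {n} → Carrier S → (Fin n → Carrier S) → Fin (nsuc n) → Carrier S
    extend x ρ zero    = x
    extend x ρ (suc k) = ρ k

    Sat : ∀ {n} → Univ n → (Fin n → Carrier S) → Set (a ⊔ e)
    Sat (qf φ)  ρ = Lift a (SatQF φ ρ)
    Sat (all φ) ρ = ∀ (x : Carrier S) → Sat φ (extend x ρ)

  module _ {m ℓm : Level} (M : Module R m ℓm) where
    open Module M

    modInterp : ∀ {n} → FunSym n → (Fin n → Carrierᴹ) → Carrierᴹ
    modInterp plus     as = as zero +ᴹ as (suc zero)
    modInterp neg      as = -ᴹ as zero
    modInterp zer      as = 0ᴹ
    modInterp (scal r) as = r *ₗ as zero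

    moduleStr : Structure m ℓm
    moduleStr = record { Carrier = Carrierᴹ ; _≈ˢ_ = _≈ᴹ_ ; interp = modInterp }

    _∈O_ : Rc → Carrierᴹ → Set (c ⊔ ℓ ⊔ ℓm)
    r ∈O x = (r *ₗ x ≈ᴹ 0ᴹ) × Regular r

    IsTorsion : Set (m ⊔ c ⊔ ℓ ⊔ ℓm)
    IsTorsion = ∀ (x : Carrierᴹ) → Σ Rc (λ r → r ∈O x)

  ultraproduct : ∀ {ι a e} {I : Set ι} → (I → Structure a e) → Ultrafilter I (a ⊔ e)
               → Structure (ι ⊔ a) (a ⊔ e)
  ultraproduct {a = a} S U = record
    { Carrier = ∀ i → Carrier (S i)
    ; _≈ˢ_    = λ f g → _∈U U (λ i → Lift a (_≈ˢ_ (S i) (f i) (g i)))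
    ; interp  = λ F fs i → interp (S i) F (λ k → fs k i)
    }

  module _ {ι m ℓm : Level} {I : Set ι} (M : I → Module R m ℓm) (U : Ultrafilter I (m ⊔ ℓm)) where

    UP : Structure (ι ⊔ m) (m ⊔ ℓm)
    UP = ultraproduct (λ i → moduleStr (M i)) U

    IsTor : Carrier UP → Set (ι ⊔ c ⊔ ℓ ⊔ lsuc (m ⊔ ℓm))
    IsTor f = Σ (I → Set (m ⊔ ℓm)) λ X → _∈U U X
              × Σ Rc (λ r → ∀ i → X i → _∈O_ (M i) r (f i))

    TorClosed : Set (ι ⊔ c ⊔ ℓ ⊔ lsuc (m ⊔ ℓm))
    TorClosed = ∀ {n} (F : FunSym n) (fs : Fin n → Carrier UP)
                → (∀ k → IsTor (fs k)) → IsTor (interp UP F fs)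

    TorCarrier : Set (ι ⊔ c ⊔ ℓ ⊔ lsuc (m ⊔ ℓm))
    TorCarrier = Σ (Carrier UP) IsTor

    torUP : TorClosed → Structure (ι ⊔ c ⊔ ℓ ⊔ lsuc (m ⊔ ℓm)) (m ⊔ ℓm)
    torUP cl = record
      { Carrier = TorCarrier
      ; _≈ˢ_    = λ x y → _≈ˢ_ UP (proj₁ x) (proj₁ y)
      ; interp  = λ F xs → interp UP F (λ k → proj₁ (xs k))
                         , cl F (λ k → proj₁ (xs k)) (λ k → proj₂ (xs k))
      }

module Submission where

-- (a) Regular elements form a multiplicative monoid, and the scalars
--     annihilating an element form an ideal; so 1 annihilates 0, r annihilates
--     -a and s·a when it annihilates a, and r·s annihilates a + b when r
--     annihilates a and s annihilates b.  This defines g_F by cases on F.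
-- (b) Torsion elements are closed under F: intersect the finitely many
--     U-large sets on which the arguments are torsion and apply (a) there.
--     An ultrafilter commutes with the Boolean connectives, and terms are
--     evaluated coordinatewise, which gives Łoś's theorem for
--     quantifier-free formulas in the substructure; universal quantifiers
--     follow by induction, instantiating them at the torsion elements.

open import Defs
open import Level using (Level; _⊔_; Lift; lift; lower)
open import Algebra.Bundles using (CommutativeRing)
open import Algebra.Module.Bundles using (Module)
open import Data.Nat using (ℕ) renaming (suc to nsuc)
open import Data.Fin using (Fin; zero; suc)
open import Data.Product using (Σ; _×_; _,_; proj₁; proj₂)
open import Data.Product.Function.NonDependent.Propositional using (_×-⇔_)
open import Data.Sum using (_⊎_; inj₁; inj₂)
open import Data.Sum.Function.Propositional using (_⊎-⇔_)
open import Data.Empty using (⊥-elim)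
open import Function using (_∘_)
open import Function.Bundles using (_⇔_; mk⇔; module Equivalence)
open import Function.Related.Propositional using (equivalence; K-reflexive; module EquationalReasoning)
open import Function.Related.TypeIsomorphisms using (¬-cong-⇔; →-cong-⇔)
open import Relation.Nullary using (¬_)
open import Relation.Binary.PropositionalEquality using (_≡_; refl; cong; cong₂)
import Relation.Binary.Reasoning.Setoid as SetoidReasoning

module TorsionOrders {c ℓ : Level} (R : CommutativeRing c ℓ) where
  open CommutativeRing R
    using (_*_; 1#; *-identityˡ; *-assoc; *-comm; sym; trans)
    renaming (Carrier to Rc)

  regular-1 : Regular R 1#
  regular-1 s 1s≈0 = trans (sym (*-identityˡ s)) 1s≈0

  regular-* : ∀ r s → Regular R r → Regular R s → Regular R (r * s)
  regular-* r s reg-r reg-s t rst≈0 =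
    reg-s t (reg-r (s * t) (trans (sym (*-assoc r s t)) rst≈0))

  module Annihilators {m ℓm : Level} (M : Module R m ℓm) where
    open Module M
    open SetoidReasoning ≈ᴹ-setoid

    annihilates-*ˡ : ∀ s {r a} → r *ₗ a ≈ᴹ 0ᴹ → (s * r) *ₗ a ≈ᴹ 0ᴹ
    annihilates-*ˡ s {r} {a} ra≈0 = begin
      (s * r) *ₗ a   ≈⟨ *ₗ-assoc s r a ⟩
      s *ₗ (r *ₗ a)  ≈⟨ *ₗ-congˡ ra≈0 ⟩
      s *ₗ 0ᴹ        ≈⟨ *ₗ-zeroʳ s ⟩
      0ᴹ             ∎

    annihilates-*ʳ : ∀ s {r a} → r *ₗ a ≈ᴹ 0ᴹ → (r * s) *ₗ a ≈ᴹ 0ᴹ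
    annihilates-*ʳ s {r} {a} ra≈0 =
      ≈ᴹ-trans (*ₗ-congʳ (*-comm r s)) (annihilates-*ˡ s ra≈0)

    annihilates-+ᴹ : ∀ {r a b} → r *ₗ a ≈ᴹ 0ᴹ → r *ₗ b ≈ᴹ 0ᴹ → r *ₗ (a +ᴹ b) ≈ᴹ 0ᴹ
    annihilates-+ᴹ {r} {a} {b} ra≈0 rb≈0 = begin
      r *ₗ (a +ᴹ b)          ≈⟨ *ₗ-distribˡ r a b ⟩
      (r *ₗ a) +ᴹ (r *ₗ b)   ≈⟨ +ᴹ-cong ra≈0 rb≈0 ⟩
      0ᴹ +ᴹ 0ᴹ               ≈⟨ +ᴹ-identityˡ 0ᴹ ⟩
      0ᴹ                     ∎

    annihilates--ᴹ : ∀ {r a} → r *ₗ a ≈ᴹ 0ᴹ → r *ₗ (-ᴹ a) ≈ᴹ 0ᴹ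
    annihilates--ᴹ {r} {a} ra≈0 = begin
      r *ₗ (-ᴹ a)                ≈⟨ ≈ᴹ-sym (+ᴹ-identityʳ _) ⟩
      (r *ₗ (-ᴹ a)) +ᴹ 0ᴹ        ≈⟨ +ᴹ-congˡ (≈ᴹ-sym ra≈0) ⟩
      (r *ₗ (-ᴹ a)) +ᴹ (r *ₗ a)  ≈⟨ ≈ᴹ-sym (*ₗ-distribˡ r (-ᴹ a) a) ⟩
      r *ₗ ((-ᴹ a) +ᴹ a)         ≈⟨ *ₗ-congˡ (-ᴹ‿inverseˡ a) ⟩
      r *ₗ 0ᴹ                    ≈⟨ *ₗ-zeroʳ r ⟩
      0ᴹ                         ∎

    annihilates-*ₗ : ∀ s {r a} → r *ₗ a ≈ᴹ 0ᴹ → r *ₗ (s *ₗ a) ≈ᴹ 0ᴹ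
    annihilates-*ₗ s {r} {a} ra≈0 =
      ≈ᴹ-trans (≈ᴹ-sym (*ₗ-assoc r s a)) (annihilates-*ʳ s ra≈0)

    ∈O-+ᴹ : ∀ {r s a b} → _∈O_ R M r a → _∈O_ R M s b → _∈O_ R M (r * s) (a +ᴹ b)
    ∈O-+ᴹ {r} {s} (ra≈0 , reg-r) (sb≈0 , reg-s) =
      annihilates-+ᴹ (annihilates-*ʳ s ra≈0) (annihilates-*ˡ r sb≈0) ,
      regular-* r s reg-r reg-s

    ∈O--ᴹ : ∀ {r a} → _∈O_ R M r a → _∈O_ R M r (-ᴹ a)
    ∈O--ᴹ (ra≈0 , reg-r) = annihilates--ᴹ ra≈0 , reg-r

    ∈O-0ᴹ : _∈O_ R M 1# 0ᴹ
    ∈O-0ᴹ = *ₗ-zeroʳ 1# , regular-1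

    ∈O-*ₗ : ∀ s {r a} → _∈O_ R M r a → _∈O_ R M r (s *ₗ a)
    ∈O-*ₗ s (ra≈0 , reg-r) = annihilates-*ₗ s ra≈0 , reg-r

  orderBound : ∀ {n} → FunSym R n → (Fin n → Rc) → Rc
  orderBound plus     rs = rs zero * rs (suc zero)
  orderBound neg      rs = rs zero
  orderBound zer      rs = 1#
  orderBound (scal s) rs = rs zero

  orderBound-correct : ∀ {m ℓm} (M : Module R m ℓm) {n} (F : FunSym R n)
    (as : Fin n → Module.Carrierᴹ M) (rs : Fin n → Rc) →
    (∀ k → _∈O_ R M (rs k) (as k)) → _∈O_ R M (orderBound F rs) (modInterp R M F as)
  orderBound-correct M plus     as rs o = ∈O-+ᴹ (o zero) (o (suc zero))
    where open Annihilators M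
  orderBound-correct M neg      as rs o = ∈O--ᴹ (o zero)
    where open Annihilators M
  orderBound-correct M zer      as rs o = ∈O-0ᴹ
    where open Annihilators M
  orderBound-correct M (scal s) as rs o = ∈O-*ₗ s (o zero)
    where open Annihilators M

module UltrafilterLogic {ι p : Level} {I : Set ι} (U : Ultrafilter I p) where

  Large : (I → Set p) → Set p
  Large X = _∈U U X

  large-⋂ : ∀ {n} (X : Fin n → I → Set p) →
    (∀ k → Large (X k)) → Large (λ i → ∀ k → X k i)
  large-⋂ {ℕ.zero} X _ = mono U (λ _ _ ()) (full U)
  large-⋂ {nsuc n} X large =
    mono U (λ _ → λ { (x₀ , xs) zero → x₀ ; (x₀ , xs) (suc k) → xs k })
      (inter U (large zero) (large-⋂ (X ∘ suc) (large ∘ suc)))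

  large-resp : ∀ {X Y : I → Set p} → (∀ i → X i ⇔ Y i) → Large X ⇔ Large Y
  large-resp X⇔Y = mk⇔ (mono U (Equivalence.to ∘ X⇔Y)) (mono U (Equivalence.from ∘ X⇔Y))

  large-¬ : ∀ (X : I → Set p) → (¬ Large X) ⇔ Large (λ i → ¬ X i)
  large-¬ X = mk⇔ complement-large disjoint
    where
    complement-large : ¬ Large X → Large (λ i → ¬ X i)
    complement-large X-small with ultra U X
    ... | inj₁ X-large  = ⊥-elim (X-small X-large)
    ... | inj₂ ¬X-large = ¬X-large

    disjoint : Large (λ i → ¬ X i) → ¬ Large X
    disjoint ¬X-large X-large =
      proper U (mono U (λ _ (¬x , x) → ⊥-elim (¬x x)) (inter U ¬X-large X-large))

  large-× : ∀ (X Y : I → Set p) → (Large X × Large Y) ⇔ Large (λ i → X i × Y i)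
  large-× X Y = mk⇔ (λ (X-large , Y-large) → inter U X-large Y-large)
                    (λ XY-large → mono U (λ _ → proj₁) XY-large , mono U (λ _ → proj₂) XY-large)

  large-⊎ : ∀ (X Y : I → Set p) → (Large X ⊎ Large Y) ⇔ Large (λ i → X i ⊎ Y i)
  large-⊎ X Y = mk⇔ union-large split
    where
    union-large : Large X ⊎ Large Y → Large (λ i → X i ⊎ Y i)
    union-large (inj₁ X-large) = mono U (λ _ → inj₁) X-large
    union-large (inj₂ Y-large) = mono U (λ _ → inj₂) Y-large

    -- if X is not large, its complement is, and on it the union is Y
    split : Large (λ i → X i ⊎ Y i) → Large X ⊎ Large Y
    split XY-large with ultra U X
    ... | inj₁ X-large  = inj₁ X-large
    ... | inj₂ ¬X-large = inj₂ (mono U only-Y (inter U ¬X-large XY-large))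
      where
      only-Y : ∀ i → ¬ X i × (X i ⊎ Y i) → Y i
      only-Y _ (¬x , inj₁ x) = ⊥-elim (¬x x)
      only-Y _ (¬x , inj₂ y) = y

  large-→ : ∀ (X Y : I → Set p) → (Large X → Large Y) ⇔ Large (λ i → X i → Y i)
  large-→ X Y = mk⇔ implication-large modus-ponens
    where
    implication-large : (Large X → Large Y) → Large (λ i → X i → Y i)
    implication-large X⇒Y with ultra U X
    ... | inj₁ X-large  = mono U (λ _ y _ → y) (X⇒Y X-large)
    ... | inj₂ ¬X-large = mono U (λ _ ¬x x → ⊥-elim (¬x x)) ¬X-large

    modus-ponens : Large (λ i → X i → Y i) → Large X → Large Y
    modus-ponens XY-large X-large = mono U (λ _ (f , x) → f x) (inter U XY-large X-large)

module _ {a ℓ : Level} {A : Set a} where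
  lift-¬ : (¬ Lift ℓ A) ⇔ Lift ℓ (¬ A)
  lift-¬ = mk⇔ (λ ¬a → lift (¬a ∘ lift)) (λ ¬a a → lower ¬a (lower a))

module _ {a b ℓ : Level} {A : Set a} {B : Set b} where

  lift-× : (Lift ℓ A × Lift ℓ B) ⇔ Lift ℓ (A × B)
  lift-× = mk⇔ (λ (a , b) → lift (lower a , lower b)) (λ ab → lift (proj₁ (lower ab)) , lift (proj₂ (lower ab)))

  lift-⊎ : (Lift ℓ A ⊎ Lift ℓ B) ⇔ Lift ℓ (A ⊎ B)
  lift-⊎ = mk⇔ (λ { (inj₁ a) → lift (inj₁ (lower a)) ; (inj₂ b) → lift (inj₂ (lower b)) })
               (λ { (lift (inj₁ a)) → inj₁ (lift a) ; (lift (inj₂ b)) → inj₂ (lift b) })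

  lift-→ : (Lift ℓ A → Lift ℓ B) ⇔ Lift ℓ (A → B)
  lift-→ = mk⇔ (λ f → lift (λ a → lower (f (lift a)))) (λ f a → lift (lower f (lower a)))

module TorsionUltraproduct {c ℓ ι m ℓm : Level} (R : CommutativeRing c ℓ) {I : Set ι}
  (M : I → Module R m ℓm) (U : Ultrafilter I (m ⊔ ℓm)) where
  open TorsionOrders R
  open UltrafilterLogic U

  -- ∏^tor M_i / U is closed under the operations of L_R: on the intersection
  -- of the sets where the arguments are torsion, g_F bounds the value.
  torClosed : TorClosed R M U
  torClosed F fs tor =
    (λ i → ∀ k → X k i) , large-⋂ X (λ k → proj₁ (proj₂ (tor k))) ,
    orderBound F r , λ i i∈X → orderBound-correct (M i) F (λ k → fs k i) r (λ k → annihilated k i (i∈X k))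
    where
    X = λ k → proj₁ (tor k)
    r = λ k → proj₁ (proj₂ (proj₂ (tor k)))
    annihilated = λ k → proj₂ (proj₂ (proj₂ (tor k)))

  T : Structure R (ι ⊔ c ⊔ ℓ ⊔ Level.suc (m ⊔ ℓm)) (m ⊔ ℓm)
  T = torUP R M U torClosed

  factor : I → Structure R m ℓm
  factor i = moduleStr R (M i)

  modInterp-cong : ∀ {m′ ℓm′} (N : Module R m′ ℓm′) {n} (F : FunSym R n)
    {as bs : Fin n → Module.Carrierᴹ N} → (∀ k → as k ≡ bs k) →
    modInterp R N F as ≡ modInterp R N F bs
  modInterp-cong N plus     as≡bs = cong₂ (Module._+ᴹ_ N) (as≡bs zero) (as≡bs (suc zero))
  modInterp-cong N neg      as≡bs = cong (Module.-ᴹ_ N) (as≡bs zero)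
  modInterp-cong N zer      as≡bs = refl
  modInterp-cong N (scal s) as≡bs = cong (Module._*ₗ_ N s) (as≡bs zero)

  Agree : ∀ {n} → (Fin n → TorCarrier R M U) → (∀ i → Fin n → Module.Carrierᴹ (M i)) → Set (ι ⊔ m)
  Agree ρ σ = ∀ i k → proj₁ (ρ k) i ≡ σ i k

  agree-extend : ∀ {n} {ρ : Fin n → TorCarrier R M U} {σ : ∀ i → Fin n → Module.Carrierᴹ (M i)}
    (x : TorCarrier R M U) → Agree ρ σ →
    Agree (extend R T x ρ) (λ i → extend R (factor i) (proj₁ x i) (σ i))
  agree-extend x agree i zero    = refl
  agree-extend x agree i (suc k) = agree i k

  module _ {n} (ρ : Fin n → TorCarrier R M U) (σ : ∀ i → Fin n → Module.Carrierᴹ (M i))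
    (agree : Agree ρ σ) where

    eval-pointwise : ∀ t i → proj₁ (eval R T ρ t) i ≡ eval R (factor i) (σ i) t
    eval-pointwise (var x)    i = agree i x
    eval-pointwise (app F ts) i = modInterp-cong (M i) F (λ k → eval-pointwise (ts k) i)

    ⟦_⟧ : QF R n → I → Set (m ⊔ ℓm)
    ⟦ ψ ⟧ i = Lift m (SatQF R (factor i) ψ (σ i))

    open EquationalReasoning {k = equivalence}

    łoś-QF : ∀ ψ → SatQF R T ψ ρ ⇔ Large ⟦ ψ ⟧
    łoś-QF (t ≐ u) = large-resp λ i →
      K-reflexive (cong₂ (λ a b → Lift m (Module._≈ᴹ_ (M i) a b)) (eval-pointwise t i) (eval-pointwise u i))
    łoś-QF (¬' ψ) = begin
      ¬ SatQF R T ψ ρ          ∼⟨ ¬-cong-⇔ (łoś-QF ψ) ⟩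
      ¬ Large ⟦ ψ ⟧            ∼⟨ large-¬ ⟦ ψ ⟧ ⟩
      Large (λ i → ¬ ⟦ ψ ⟧ i)  ∼⟨ large-resp (λ _ → lift-¬) ⟩
      Large ⟦ ¬' ψ ⟧           ∎
    łoś-QF (ψ ∧' χ) = begin
      (SatQF R T ψ ρ × SatQF R T χ ρ) ∼⟨ łoś-QF ψ ×-⇔ łoś-QF χ ⟩
      (Large ⟦ ψ ⟧ × Large ⟦ χ ⟧)     ∼⟨ large-× ⟦ ψ ⟧ ⟦ χ ⟧ ⟩
      Large (λ i → ⟦ ψ ⟧ i × ⟦ χ ⟧ i) ∼⟨ large-resp (λ _ → lift-×) ⟩
      Large ⟦ ψ ∧' χ ⟧                ∎
    łoś-QF (ψ ∨' χ) = begin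
      (SatQF R T ψ ρ ⊎ SatQF R T χ ρ) ∼⟨ łoś-QF ψ ⊎-⇔ łoś-QF χ ⟩
      (Large ⟦ ψ ⟧ ⊎ Large ⟦ χ ⟧)     ∼⟨ large-⊎ ⟦ ψ ⟧ ⟦ χ ⟧ ⟩
      Large (λ i → ⟦ ψ ⟧ i ⊎ ⟦ χ ⟧ i) ∼⟨ large-resp (λ _ → lift-⊎) ⟩
      Large ⟦ ψ ∨' χ ⟧                ∎
    łoś-QF (ψ ⇒' χ) = begin
      (SatQF R T ψ ρ → SatQF R T χ ρ)   ∼⟨ →-cong-⇔ (łoś-QF ψ) (łoś-QF χ) ⟩
      (Large ⟦ ψ ⟧ → Large ⟦ χ ⟧)       ∼⟨ large-→ ⟦ ψ ⟧ ⟦ χ ⟧ ⟩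
      Large (λ i → ⟦ ψ ⟧ i → ⟦ χ ⟧ i)   ∼⟨ large-resp (λ _ → lift-→) ⟩
      Large ⟦ ψ ⇒' χ ⟧                  ∎

  -- Universal formulas holding in U-almost every factor hold in ∏^tor M_i / U:
  -- each universal instance over T is a universal instance in the factors.
  łoś-Univ : ∀ {n} (φ : Univ R n) (ρ : Fin n → TorCarrier R M U)
    (σ : ∀ i → Fin n → Module.Carrierᴹ (M i)) → Agree ρ σ →
    Large (λ i → Sat R (factor i) φ (σ i)) → Sat R T φ ρ
  łoś-Univ (qf ψ)  ρ σ agree holds = lift (Equivalence.from (łoś-QF ρ σ agree ψ) holds)
  łoś-Univ (all φ) ρ σ agree holds x =
    łoś-Univ φ (extend R T x ρ) (λ i → extend R (factor i) (proj₁ x i) (σ i))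
      (agree-extend x agree) (mono U (λ i ∀φ → ∀φ (proj₁ x i)) holds)

proposition5p1 : ∀ {c ℓ m ℓm ι} (R : CommutativeRing c ℓ) →
    (∀ {n} (F : FunSym R n) →
      Σ ((Fin n → CommutativeRing.Carrier R) → CommutativeRing.Carrier R) λ g →
        (M : Module R m ℓm) → IsTorsion R M →
        (as : Fin n → Module.Carrierᴹ M) (rs : Fin n → CommutativeRing.Carrier R) →
        (∀ k → _∈O_ R M (rs k) (as k)) →
        _∈O_ R M (g rs) (modInterp R M F as))
    ×
    ((I : Set ι) (M : I → Module R m ℓm) → (∀ i → IsTorsion R (M i)) →
      (U : Ultrafilter I (m ⊔ ℓm)) →
      Σ (TorClosed R M U) λ cl →
        ∀ {n} (φ : Univ R n) (fs : Fin n → TorCarrier R M U) →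
        _∈U U (λ i → Sat R (moduleStr R (M i)) φ (λ k → proj₁ (fs k) i)) →
        Sat R (torUP R M U cl) φ fs)
proposition5p1 R =
  (λ F → orderBound F , λ M _ → orderBound-correct M F) ,
  (λ I M _ U → let open TorsionUltraproduct R M U in
     torClosed , λ φ fs → łoś-Univ φ fs (λ i k → proj₁ (fs k) i) (λ _ _ → refl))
  where open TorsionOrders R
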